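{- For $n\ge4$ let $f_n(x_1,\ldots,x_n)=x_1x_2\vee x_1x_3\vee\cdots\vee x_1x_{n-1}\vee x_2x_3\cdots x_n$. Then $f_n$ is a positive threshold function depending on all its variables, $f_n$ is not linear read-once, and its specification number in $\mathcal{H}_n$ is $\sigma_{\mathcal{H}_n}(f_n)=n+1$.
   Context: $B=\{0,1\}$. $f$ on $B^n$ is positive if $f(\mathbf{x})=1$ and $\mathbf{x}\preceq\mathbf{y}$ (coordinatewise) imply $f(\mathbf{y})=1$. $f$ is a threshold function if there are reals $w_1,\ldots,w_n,t$ with $f(\mathbf{x})=0\iff\sum w_ix_i\le t$ for all $\mathbf{x}\in B^n$. $\mathcal{H}_n$ is the class of threshold functions of $n$ variables. A set $S\subseteq B^n$ specifies $f\in\mathcal{H}_n$ if $f$ is the only function in $\mathcal{H}_n$ agreeing with $f$ on $S$; $\sigma_{\mathcal{H}_n}(f)$ is the minimum size of such a set. A function is linear read-once (lro) if it is constant or representable by a nested formula: literals $x,\overline{x}$ are nested formulas, and if $t$ is a nested formula not containing $x$ or $\overline{x}$ then $x\vee t$, $x\wedge t$, $\overline{x}\vee t$, $\overline{x}\wedge t$ are nested formulas.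
   Formalization: The weights and threshold $w_1,\ldots,w_n,t$ defining threshold functions, and so the class $\mathcal{H}_n$, are rational instead of real. -}

module Defs where

open import Data.Bool using (Bool; true; false; _∧_; _∨_; not; if_then_else_)
open import Data.Nat using (ℕ; zero; suc; _≤_)
open import Data.Fin using (Fin)
open import Data.Vec using (Vec; []; _∷_; lookup; _[_]%=_)
open import Data.List using (List; length)
open import Data.List.Relation.Unary.All using (All)
open import Data.List.Relation.Unary.Unique.Propositional using (Unique)
open import Data.Rational using (ℚ; 0ℚ; _+_; _≤_)
open import Data.Product using (Σ; _×_; ∃)
open import Data.Sum using (_⊎_)
open import Relation.Binary.PropositionalEquality using (_≡_; _≢_)
open import Relation.Nullary using (¬_)
open import Function.Bundles using (_⇔_)
open import Data.Unit using (⊤)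

Point : ℕ → Set
Point n = Vec Bool n

BoolFn : ℕ → Set
BoolFn n = Point n → Bool

_⪯_ : ∀ {n} → Point n → Point n → Set
x ⪯ y = ∀ i → lookup x i ≡ true → lookup y i ≡ true

Positive : ∀ {n} → BoolFn n → Set
Positive {n} f = ∀ (x y : Point n) → f x ≡ true → x ⪯ y → f y ≡ true

dot : ∀ {n} → Vec ℚ n → Point n → ℚ
dot [] [] = 0ℚ
dot (w ∷ ws) (b ∷ xs) = (if b then w else 0ℚ) + dot ws xs

IsThreshold : ∀ {n} → BoolFn n → Set
IsThreshold {n} f = Σ (Vec ℚ n) λ w → Σ ℚ λ t →
  ∀ (x : Point n) → (f x ≡ false) ⇔ (dot w x Data.Rational.≤ t)

flip : ∀ {n} → Point n → Fin n → Point n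
flip x i = x [ i ]%= not

DependsOnAll : ∀ {n} → BoolFn n → Set
DependsOnAll {n} f = ∀ (i : Fin n) → ∃ λ (x : Point n) → f x ≢ f (flip x i)

data Op : Set where
  OR AND : Op

-- lit i p : the literal x_i if p = true, its negation if p = false
-- ext o i p t : (literal) o t
data Formula (n : ℕ) : Set where
  lit : Fin n → Bool → Formula n
  ext : Op → Fin n → Bool → Formula n → Formula n

Occurs : ∀ {n} → Fin n → Formula n → Set
Occurs i (lit j p) = i ≡ j
Occurs i (ext o j p t) = i ≡ j ⊎ Occurs i t

Nested : ∀ {n} → Formula n → Set
Nested (lit i p) = ⊤
Nested (ext o i p t) = ¬ Occurs i t × Nested t

litVal : ∀ {n} → Fin n → Bool → Point n → Bool
litVal i true x = lookup x i
litVal i false x = not (lookup x i)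

eval : ∀ {n} → Formula n → Point n → Bool
eval (lit i p) x = litVal i p x
eval (ext OR i p t) x = litVal i p x ∨ eval t x
eval (ext AND i p t) x = litVal i p x ∧ eval t x

IsConstant : ∀ {n} → BoolFn n → Set
IsConstant {n} f = (∀ (x : Point n) → f x ≡ true) ⊎ (∀ (x : Point n) → f x ≡ false)

LRO : ∀ {n} → BoolFn n → Set
LRO {n} f = IsConstant f ⊎ Σ (Formula n) λ φ → Nested φ × (∀ (x : Point n) → f x ≡ eval φ x)

Specifies : ∀ {n} → List (Point n) → BoolFn n → Set
Specifies {n} S f = IsThreshold f ×
  (∀ (g : BoolFn n) → IsThreshold g → All (λ x → g x ≡ f x) S → ∀ (x : Point n) → g x ≡ f x)

SpecNumber : ∀ {n} → BoolFn n → ℕ → Set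
SpecNumber {n} f k =
  (Σ (List (Point n)) λ S → Unique S × length S ≡ k × Specifies S f)
  × (∀ (S : List (Point n)) → Specifies S f → k Data.Nat.≤ length S)

orButLast : ∀ {m} → Vec Bool m → Bool
orButLast [] = false
orButLast (a ∷ []) = false
orButLast (a ∷ b ∷ r) = a ∨ orButLast (b ∷ r)

andAll : ∀ {m} → Vec Bool m → Bool
andAll [] = true
andAll (a ∷ r) = a ∧ andAll r

fn : ∀ {n} → BoolFn n
fn [] = false
fn (x1 ∷ rest) = (x1 ∧ orButLast rest) ∨ andAll rest

{-# OPTIONS --safe #-}

-- Write n = p + 3 and a point of Bⁿ as (x₁, mid, xₙ) with mid ∈ B^(p+1). The minimal true points
-- of fn are Pⱼ = (1, eⱼ, 0) and Q = (0, 1, 1); its maximal false points are R = (1, 0, 1),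
-- T = (0, 1, 0) and Uⱼ = (0, 1 - eⱼ, 1). Every point lies above a minimal true point or below a
-- maximal false one, so a positive function that agrees with fn on these points is fn. This
-- shows that fn is the threshold function (2p+1)x₁ + 2(x₂ + ⋯ + x_{n-1}) + xₙ > 2p+2, and that
-- S₀ = {Q, R, T, P₀, …, Pₚ} specifies fn: the inequalities a threshold function g must satisfy
-- on S₀ force its weights to be nonnegative (so g is positive) and force g(Uⱼ) = 0. Conversely,
-- for each point of S₀ an explicit threshold function differs from fn exactly there, so S₀ lies
-- in every specifying set and σ(fn) = |S₀| = n + 1. Finally fn vanishes at 0 and at every eᵢ
-- and is 1 at 1 and at every 1 - eᵢ (n ≥ 4), so no literal can be the outermost one of a
-- nested formula for fn.

module Submission where

open import Defs
open import Data.Nat using (ℕ; _≤_; suc)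
open import Data.Product using (_×_)
open import Relation.Nullary using (¬_)

open import Algebra.Core using (Op₂)
open import Algebra.Structures using (IsCommutativeMonoid)
open import Data.Bool as Bool using (Bool; true; false; not; _∧_; _∨_; if_then_else_)
open import Data.Bool.Properties using (≤-minimum; ≤-maximum; ∨-zeroʳ; ∧-zeroʳ; ∧-identityʳ; ¬-not)
open import Data.Empty using (⊥)
open import Data.Fin using (Fin; zero; suc; inject₁; fromℕ; _≟_)
open import Data.Fin.Properties using (suc-injective)
import Data.Integer as ℤ
import Data.Integer.Properties as ℤₚ
open import Data.List as List using (List; []; _∷_; [_]; length; _++_; allFin)
open import Data.List.Membership.Propositional using (_∈_)
open import Data.List.Membership.Propositional.Properties using (∈-∃++; ∈-++⁻; ∈-++⁺ˡ; ∈-++⁺ʳ; ∈-allFin)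
open import Data.List.Properties using (length-map; length-tabulate; length-++-sucʳ)
open import Data.List.Relation.Unary.All as ListAll using ([]; _∷_)
import Data.List.Relation.Unary.All.Properties as ListAllₚ
open import Data.List.Relation.Unary.AllPairs using ([]; _∷_)
open import Data.List.Relation.Unary.Any as Any using (here; there)
open import Data.List.Relation.Unary.Unique.Propositional using (Unique)
import Data.List.Relation.Unary.Unique.Propositional.Properties as Uniqueₚ
open import Data.Nat using (zero; _+_; _*_; _<_; _<?_; z≤n; s≤s)
open import Data.Nat.Properties
  using (+-0-isCommutativeMonoid; +-commutativeSemigroup; +-assoc; +-cancelʳ-≡; +-cancelʳ-≤; +-monoʳ-≤;
         m≤m+n; ≤-reflexive; ≤⇒≯; ≮⇒≥; module ≤-Reasoning)
open import Algebra.Properties.CommutativeSemigroup +-commutativeSemigroup using (xy∙z≈zy∙x; xy∙z≈yz∙x)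
open import Data.Nat.Tactic.RingSolver using (solve)
open import Data.Product using (∃; _,_; proj₂)
open import Data.Rational as ℚ using (ℚ; 0ℚ)
open import Data.Rational.Literals using (fromℤ)
import Data.Rational.Properties as ℚₚ
import Data.Rational.Unnormalised as ℚᵘ
import Data.Rational.Unnormalised.Properties as ℚᵘₚ
open import Data.Sum using (_⊎_; inj₁; inj₂)
import Data.Vec as Vec
open import Data.Vec using (Vec; _∷_; []; _∷ʳ_; replicate; lookup; initLast; _[_]%=_; _[_]≔_)
open import Data.Vec.Properties
  using (≡-dec; lookup-replicate; lookup∘updateAt; lookup∘updateAt′; ∷-injectiveʳ; ∷ʳ-injectiveˡ; ∷ʳ-injectiveʳ)
import Data.Vec.Relation.Binary.Pointwise.Inductive as Pointwise
open Pointwise using (Pointwise; _∷_; [])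
open import Data.Vec.Relation.Unary.All using (All; []; _∷_)
import Data.Vec.Relation.Unary.All.Properties as Allₚ
open import Function using (_∘_; id)
open import Function.Bundles using (_⇔_; mk⇔; Equivalence)
open import Relation.Binary.PropositionalEquality
  using (_≡_; _≢_; refl; sym; trans; cong; cong₂; subst; subst₂; module ≡-Reasoning)
open import Relation.Nullary using (yes; no; does; contradiction)
open import Relation.Nullary.Decidable using (dec-true; dec-false)

-- Framed points and the coordinatewise order

frame : ∀ {A : Set} {m} → A → Vec A m → A → Vec A (2 + m)
frame a mid b = a ∷ (mid ∷ʳ b)

data FrameView {A : Set} {m} : Vec A (2 + m) → Set where
  framed : ∀ a mid b → FrameView (frame a mid b)

frameView : ∀ {A : Set} {m} (v : Vec A (2 + m)) → FrameView v
frameView (a ∷ rest) with initLast rest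
... | mid , b , refl = framed a mid b

data CoordView {m} : Fin (2 + m) → Set where
  first  : CoordView zero
  middle : ∀ j → CoordView (suc (inject₁ j))
  final  : CoordView (suc (fromℕ m))

coordView : ∀ {m} (i : Fin (2 + m)) → CoordView i
coordView zero                  = first
coordView {zero}  (suc zero)    = final
coordView {suc m} (suc zero)    = middle zero
coordView {suc m} (suc (suc i)) with coordView {m} (suc i)
... | middle j = middle (suc j)
... | final    = final

∷ʳ-updateAt-inject₁ : ∀ {A : Set} {m} (v : Vec A m) b j (f : A → A) →
                      (v ∷ʳ b) [ inject₁ j ]%= f ≡ (v [ j ]%= f) ∷ʳ b
∷ʳ-updateAt-inject₁ (x ∷ v) b zero    f = refl
∷ʳ-updateAt-inject₁ (x ∷ v) b (suc j) f = cong (x ∷_) (∷ʳ-updateAt-inject₁ v b j f)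

∷ʳ-updateAt-fromℕ : ∀ {A : Set} {m} (v : Vec A m) b (f : A → A) → (v ∷ʳ b) [ fromℕ m ]%= f ≡ v ∷ʳ f b
∷ʳ-updateAt-fromℕ []      b f = refl
∷ʳ-updateAt-fromℕ (x ∷ v) b f = cong (x ∷_) (∷ʳ-updateAt-fromℕ v b f)

flip-middle : ∀ {m} a (mid : Point m) b j → flip (frame a mid b) (suc (inject₁ j)) ≡ frame a (flip mid j) b
flip-middle a mid b j = cong (a ∷_) (∷ʳ-updateAt-inject₁ mid b j not)

flip-final : ∀ {m} a (mid : Point m) b → flip (frame a mid b) (suc (fromℕ m)) ≡ frame a mid (not b)
flip-final a mid b = cong (a ∷_) (∷ʳ-updateAt-fromℕ mid b not)

replicate-∷ʳ : ∀ {A : Set} m (x : A) → replicate (suc m) x ≡ replicate m x ∷ʳ x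
replicate-∷ʳ zero    x = refl
replicate-∷ʳ (suc m) x = cong (x ∷_) (replicate-∷ʳ m x)

replicate-frame : ∀ {A : Set} m (x : A) → replicate (2 + m) x ≡ frame x (replicate m x) x
replicate-frame m x = cong (x ∷_) (replicate-∷ʳ m x)

unit unitᶜ : ∀ {m} → Fin m → Point m
unit  i = flip (replicate _ false) i
unitᶜ i = flip (replicate _ true) i

lookup∘flip : ∀ {m} (v : Point m) i → lookup (flip v i) i ≡ not (lookup v i)
lookup∘flip v i = lookup∘updateAt i v

lookup∘flip′ : ∀ {m} (v : Point m) {i j} → j ≢ i → lookup (flip v i) j ≡ lookup v j
lookup∘flip′ v {i} {j} j≢i = lookup∘updateAt′ j i j≢i v

lookup-unit : ∀ {m} (i : Fin m) → lookup (unit i) i ≡ true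
lookup-unit i = trans (lookup∘flip (replicate _ false) i) (cong not (lookup-replicate i false))

lookup-unit′ : ∀ {m} {i j : Fin m} → j ≢ i → lookup (unit i) j ≡ false
lookup-unit′ {j = j} j≢i = trans (lookup∘flip′ (replicate _ false) j≢i) (lookup-replicate j false)

lookup-unitᶜ′ : ∀ {m} {i j : Fin m} → j ≢ i → lookup (unitᶜ i) j ≡ true
lookup-unitᶜ′ {j = j} j≢i = trans (lookup∘flip′ (replicate _ true) j≢i) (lookup-replicate j true)

unit-injective : ∀ {m} {i j : Fin m} → unit i ≡ unit j → i ≡ j
unit-injective {i = i} {j} eq with i ≟ j
... | yes i≡j = i≡j
... | no  i≢j =
  contradiction (trans (sym (lookup-unit i)) (trans (cong (λ v → lookup v i) eq) (lookup-unit′ i≢j))) λ ()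

another : ∀ {k} (i : Fin (2 + k)) → ∃ λ j → j ≢ i
another zero    = suc zero , λ ()
another (suc i) = zero , λ ()

constant-or-lookup : ∀ {m} c (v : Point m) → v ≡ replicate m c ⊎ ∃ λ i → lookup v i ≡ not c
constant-or-lookup c []      = inj₁ refl
constant-or-lookup c (x ∷ v) with x Bool.≟ c | constant-or-lookup c v
... | no x≢c   | _             = inj₂ (zero , ¬-not x≢c)
... | yes refl | inj₁ refl     = inj₁ refl
... | yes refl | inj₂ (i , vᵢ) = inj₂ (suc i , vᵢ)

unit-or-another : ∀ {m} (v : Point m) i → lookup v i ≡ true →
                  v ≡ unit i ⊎ ∃ λ j → j ≢ i × lookup v j ≡ true
unit-or-another (x ∷ v) zero refl with constant-or-lookup false v
... | inj₁ refl     = inj₁ refl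
... | inj₂ (j , vⱼ) = inj₂ (suc j , (λ ()) , vⱼ)
unit-or-another (x ∷ v) (suc i) vᵢ with unit-or-another v i vᵢ
... | inj₂ (j , j≢i , vⱼ) = inj₂ (suc j , j≢i ∘ suc-injective , vⱼ)
... | inj₁ refl with x
...   | false = inj₁ refl
...   | true  = inj₂ (zero , (λ ()) , refl)

infix 4 _⊑_
_⊑_ : ∀ {n} → Point n → Point n → Set
_⊑_ = Pointwise Bool._≤_

⊑⇒⪯ : ∀ {n} {x y : Point n} → x ⊑ y → x ⪯ y
⊑⇒⪯ x⊑y i = ≤-true (Pointwise.lookup x⊑y i)
  where
  ≤-true : ∀ {a b} → a Bool.≤ b → a ≡ true → b ≡ true
  ≤-true Bool.b≤b a≡true = a≡true
  ≤-true Bool.f≤t _      = refl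

⪯⇒⊑ : ∀ {n} (x y : Point n) → x ⪯ y → x ⊑ y
⪯⇒⊑ []      []      _   = []
⪯⇒⊑ (a ∷ x) (b ∷ y) x⪯y = head-≤ a b (x⪯y zero) ∷ ⪯⇒⊑ x y (λ i → x⪯y (suc i))
  where
  head-≤ : ∀ a b → (a ≡ true → b ≡ true) → a Bool.≤ b
  head-≤ false b _                     = ≤-minimum b
  head-≤ true  b a⇒b rewrite a⇒b refl = Bool.b≤b

∷ʳ-⊑ : ∀ {m} {xs ys : Point m} {a b} → xs ⊑ ys → a Bool.≤ b → xs ∷ʳ a ⊑ ys ∷ʳ b
∷ʳ-⊑ []            a≤b = a≤b ∷ []
∷ʳ-⊑ (x≤y ∷ xs⊑ys) a≤b = x≤y ∷ ∷ʳ-⊑ xs⊑ys a≤b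

frame-⊑ : ∀ {m} {a a′ b b′} {mid mid′ : Point m} →
          a Bool.≤ a′ → mid ⊑ mid′ → b Bool.≤ b′ → frame a mid b ⊑ frame a′ mid′ b′
frame-⊑ a≤a′ mid⊑mid′ b≤b′ = a≤a′ ∷ ∷ʳ-⊑ mid⊑mid′ b≤b′

zeros-⊑ : ∀ {m} (v : Point m) → replicate m false ⊑ v
zeros-⊑ []      = []
zeros-⊑ (b ∷ v) = ≤-minimum b ∷ zeros-⊑ v

⊑-ones : ∀ {m} (v : Point m) → v ⊑ replicate m true
⊑-ones []      = []
⊑-ones (b ∷ v) = ≤-maximum b ∷ ⊑-ones v

unit-⊑ : ∀ {m} (v : Point m) {i} → lookup v i ≡ true → unit i ⊑ v
unit-⊑ (_ ∷ v) {zero}  refl = Bool.b≤b ∷ zeros-⊑ v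
unit-⊑ (b ∷ v) {suc i} vᵢ   = ≤-minimum b ∷ unit-⊑ v vᵢ

⊑-unitᶜ : ∀ {m} (v : Point m) {j} → lookup v j ≡ false → v ⊑ unitᶜ j
⊑-unitᶜ (_ ∷ v) {zero}  refl = Bool.b≤b ∷ ⊑-ones v
⊑-unitᶜ (b ∷ v) {suc j} vⱼ   = ≤-maximum b ∷ ⊑-unitᶜ v vⱼ

module Monotone {n} {g : BoolFn n} (g-positive : Positive g) where

  true-above : ∀ {u x} → u ⊑ x → g u ≡ true → g x ≡ true
  true-above u⊑x gu = g-positive _ _ gu (⊑⇒⪯ u⊑x)

  false-below : ∀ {x u} → x ⊑ u → g u ≡ false → g x ≡ false
  false-below x⊑u gu = ¬-not λ gx → contradiction (trans (sym gu) (g-positive _ _ gx (⊑⇒⪯ x⊑u))) λ ()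

-- The values of fn

orButLast-∷ʳ-lookup : ∀ {m} (v : Point m) b i → lookup v i ≡ true → orButLast (v ∷ʳ b) ≡ true
orButLast-∷ʳ-lookup (x ∷ [])    b zero    refl = refl
orButLast-∷ʳ-lookup (x ∷ y ∷ v) b zero    refl = refl
orButLast-∷ʳ-lookup (x ∷ y ∷ v) b (suc i) vᵢ   =
  trans (cong (x ∨_) (orButLast-∷ʳ-lookup (y ∷ v) b i vᵢ)) (∨-zeroʳ x)

orButLast-∷ʳ-zeros : ∀ m b → orButLast (replicate m false ∷ʳ b) ≡ false
orButLast-∷ʳ-zeros zero          b = refl
orButLast-∷ʳ-zeros (suc zero)    b = refl
orButLast-∷ʳ-zeros (suc (suc m)) b = orButLast-∷ʳ-zeros (suc m) b

andAll-∷ʳ⁺-lookup : ∀ {m} (v : Point m) b j → lookup v j ≡ false → andAll (v ∷ʳ b) ≡ false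
andAll-∷ʳ⁺-lookup (x ∷ v) b zero    refl = refl
andAll-∷ʳ⁺-lookup (x ∷ v) b (suc j) vⱼ   = trans (cong (x ∧_) (andAll-∷ʳ⁺-lookup v b j vⱼ)) (∧-zeroʳ x)

andAll-∷ʳ⁺-ones : ∀ m b → andAll (replicate m true ∷ʳ b) ≡ b
andAll-∷ʳ⁺-ones zero    b = ∧-identityʳ b
andAll-∷ʳ⁺-ones (suc m) b = andAll-∷ʳ⁺-ones m b

P P⁺ U : ∀ {m} → Fin m → Point (2 + m)
P  i = frame true (unit i) false
P⁺ i = frame true (unit i) true
U  j = frame false (unitᶜ j) true

Q R R⁻ T : ∀ {m} → Point (2 + m)
Q  = frame false (replicate _ true) true
R  = frame true (replicate _ false) true
R⁻ = frame true (replicate _ false) false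
T  = frame false (replicate _ true) false

fn-Q : ∀ m → fn (Q {m}) ≡ true
fn-Q m = andAll-∷ʳ⁺-ones m true

fn-T : ∀ m → fn (T {m}) ≡ false
fn-T m = andAll-∷ʳ⁺-ones m false

fn-above-P : ∀ {m} (mid : Point m) {i} b → lookup mid i ≡ true → fn (frame true mid b) ≡ true
fn-above-P mid {i} b midᵢ = cong (_∨ andAll (mid ∷ʳ b)) (orButLast-∷ʳ-lookup mid b i midᵢ)

fn-below-U : ∀ {m} (mid : Point m) {j} b → lookup mid j ≡ false → fn (frame false mid b) ≡ false
fn-below-U mid {j} b midⱼ = andAll-∷ʳ⁺-lookup mid b j midⱼ

fn-below-R : ∀ p b → fn (frame true (replicate (suc p) false) b) ≡ false
fn-below-R p b =
  cong₂ _∨_ (orButLast-∷ʳ-zeros (suc p) b) (andAll-∷ʳ⁺-lookup (replicate (suc p) false) b zero refl)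

data FnView {m} : Point (2 + m) → Set where
  below-R : ∀ b → FnView (frame true (replicate m false) b)
  above-P : ∀ {mid} b i → lookup mid i ≡ true → FnView (frame true mid b)
  below-U : ∀ {mid} b j → lookup mid j ≡ false → FnView (frame false mid b)
  at-Q    : FnView Q
  at-T    : FnView T

fnView : ∀ {m} (x : Point (2 + m)) → FnView x
fnView x with frameView x
... | framed true mid b with constant-or-lookup false mid
...   | inj₁ refl       = below-R b
...   | inj₂ (i , midᵢ) = above-P b i midᵢ
fnView x | framed false mid b with constant-or-lookup true mid
...   | inj₂ (j , midⱼ) = below-U b j midⱼ
...   | inj₁ refl with b
...     | true  = at-Q
...     | false = at-T

-- In fn↑x-determined (fn↓x-determined) g stands for fn with its value at the false (true) point x
-- switched.

module Agreement {p} {g : BoolFn (3 + p)} (g-positive : Positive g) where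
  open Monotone g-positive

  on-below-R : ∀ b → g R ≡ false →
               g (frame true (replicate (suc p) false) b) ≡ fn (frame true (replicate (suc p) false) b)
  on-below-R b gR =
    trans (false-below (frame-⊑ Bool.b≤b (zeros-⊑ (replicate (suc p) false)) (≤-maximum b)) gR)
          (sym (fn-below-R p b))

  on-above-P : ∀ {mid} b i → lookup mid i ≡ true → g (P i) ≡ true → g (frame true mid b) ≡ fn (frame true mid b)
  on-above-P {mid} b i midᵢ gP =
    trans (true-above (frame-⊑ Bool.b≤b (unit-⊑ mid midᵢ) (≤-minimum b)) gP) (sym (fn-above-P mid b midᵢ))

  on-below-U : ∀ {mid} b j → lookup mid j ≡ false → g (U j) ≡ false →
               g (frame false mid b) ≡ fn (frame false mid b)
  on-below-U {mid} b j midⱼ gU =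
    trans (false-below (frame-⊑ Bool.b≤b (⊑-unitᶜ mid midⱼ) (≤-maximum b)) gU) (sym (fn-below-U mid b midⱼ))

  fn-determined : (∀ j → g (P j) ≡ true) → g Q ≡ true → g R ≡ false → g T ≡ false →
                  (∀ j → g (U j) ≡ false) → ∀ x → g x ≡ fn x
  fn-determined gP gQ gR gT gU x with fnView x
  ... | below-R b        = on-below-R b gR
  ... | above-P b i midᵢ = on-above-P b i midᵢ (gP i)
  ... | below-U b j midⱼ = on-below-U b j midⱼ (gU j)
  ... | at-Q             = trans gQ (sym (fn-Q (suc p)))
  ... | at-T             = trans gT (sym (fn-T (suc p)))

  fn↑R-determined : (∀ j → g (P j) ≡ true) → g Q ≡ true → g R⁻ ≡ false → g T ≡ false →
                    (∀ j → g (U j) ≡ false) → ∀ x → x ≢ R → g x ≡ fn x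
  fn↑R-determined gP gQ gR⁻ gT gU x x≢R with fnView x
  ... | below-R true     = contradiction refl x≢R
  ... | below-R false    = trans gR⁻ (sym (fn-below-R p false))
  ... | above-P b i midᵢ = on-above-P b i midᵢ (gP i)
  ... | below-U b j midⱼ = on-below-U b j midⱼ (gU j)
  ... | at-Q             = trans gQ (sym (fn-Q (suc p)))
  ... | at-T             = trans gT (sym (fn-T (suc p)))

  fn↑T-determined : (∀ j → g (P j) ≡ true) → g Q ≡ true → g R ≡ false → (∀ j → g (U j) ≡ false) →
                    ∀ x → x ≢ T → g x ≡ fn x
  fn↑T-determined gP gQ gR gU x x≢T with fnView x
  ... | below-R b        = on-below-R b gR
  ... | above-P b i midᵢ = on-above-P b i midᵢ (gP i)
  ... | below-U b j midⱼ = on-below-U b j midⱼ (gU j)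
  ... | at-Q             = trans gQ (sym (fn-Q (suc p)))
  ... | at-T             = contradiction refl x≢T

  fn↓Q-determined : (∀ j → g (P j) ≡ true) → g R ≡ false → g T ≡ false → (∀ j → g (U j) ≡ false) →
                    ∀ x → x ≢ Q → g x ≡ fn x
  fn↓Q-determined gP gR gT gU x x≢Q with fnView x
  ... | below-R b        = on-below-R b gR
  ... | above-P b i midᵢ = on-above-P b i midᵢ (gP i)
  ... | below-U b j midⱼ = on-below-U b j midⱼ (gU j)
  ... | at-Q             = contradiction refl x≢Q
  ... | at-T             = trans gT (sym (fn-T (suc p)))

  fn↓P-determined : ∀ i → (∀ j → j ≢ i → g (P j) ≡ true) → g (P⁺ i) ≡ true → g Q ≡ true → g R ≡ false →
                    g T ≡ false → (∀ j → g (U j) ≡ false) → ∀ x → x ≢ P i → g x ≡ fn x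
  fn↓P-determined i gP gP⁺ gQ gR gT gU x x≢Pᵢ with fnView x
  ... | below-R b        = on-below-R b gR
  ... | below-U b j midⱼ = on-below-U b j midⱼ (gU j)
  ... | at-Q             = trans gQ (sym (fn-Q (suc p)))
  ... | at-T             = trans gT (sym (fn-T (suc p)))
  ... | above-P {mid} b k midₖ with k ≟ i
  ...   | no k≢i   = on-above-P b k midₖ (gP k k≢i)
  ...   | yes refl with unit-or-another mid i midₖ
  ...     | inj₂ (j , j≢i , midⱼ) = on-above-P b j midⱼ (gP j j≢i)
  ...     | inj₁ refl with b
  ...       | true  = trans gP⁺ (sym (fn-above-P (unit i) true (lookup-unit i)))
  ...       | false = contradiction refl x≢Pᵢ

-- Weighted sums and threshold functions

module WeightedSum {A : Set} {_+_ : Op₂ A} {0# : A} (isCM : IsCommutativeMonoid _≡_ _+_ 0#) where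
  open IsCommutativeMonoid isCM using (assoc; comm; identityˡ; identityʳ)

  select : Bool → A → A
  select b w = if b then w else 0#

  infix 7 _·_
  _·_ : ∀ {n} → Vec A n → Point n → A
  []       · []      = 0#
  (w ∷ ws) · (b ∷ x) = select b w + (ws · x)

  total : ∀ {n} → Vec A n → A
  total []       = 0#
  total (w ∷ ws) = w + total ws

  ·-∷ʳ : ∀ {n} (ws : Vec A n) w (x : Point n) b → (ws ∷ʳ w) · (x ∷ʳ b) ≡ (ws · x) + select b w
  ·-∷ʳ []       w []      b = trans (identityʳ _) (sym (identityˡ _))
  ·-∷ʳ (v ∷ ws) w (c ∷ x) b = trans (cong (select c v +_) (·-∷ʳ ws w x b)) (sym (assoc _ _ _))

  ·-frame : ∀ {m} w₁ (ws : Vec A m) wₙ a (x : Point m) b →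
            frame w₁ ws wₙ · frame a x b ≡ select a w₁ + ((ws · x) + select b wₙ)
  ·-frame w₁ ws wₙ a x b = cong (select a w₁ +_) (·-∷ʳ ws wₙ x b)

  ·-zeros : ∀ {n} (ws : Vec A n) → ws · replicate n false ≡ 0#
  ·-zeros []       = refl
  ·-zeros (w ∷ ws) = trans (identityˡ _) (·-zeros ws)

  ·-unit : ∀ {n} (ws : Vec A n) i → ws · unit i ≡ lookup ws i
  ·-unit (w ∷ ws) zero    = trans (cong (w +_) (·-zeros ws)) (identityʳ w)
  ·-unit (w ∷ ws) (suc i) = trans (identityˡ _) (·-unit ws i)

  ·-ones : ∀ {n} (ws : Vec A n) → ws · replicate n true ≡ total ws
  ·-ones []       = refl
  ·-ones (w ∷ ws) = cong (w +_) (·-ones ws)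

  ·-unitᶜ : ∀ {n} (ws : Vec A n) j → (ws · unitᶜ j) + lookup ws j ≡ total ws
  ·-unitᶜ (w ∷ ws) zero    = trans (cong (_+ w) (trans (identityˡ _) (·-ones ws))) (comm _ w)
  ·-unitᶜ (w ∷ ws) (suc j) = trans (assoc w _ _) (cong (w +_) (·-unitᶜ ws j))

  module _ {m} (w₁ : A) (ws : Vec A m) (wₙ : A) where

    ·-P : ∀ i → frame w₁ ws wₙ · P i ≡ w₁ + lookup ws i
    ·-P i = trans (·-frame w₁ ws wₙ true (unit i) false) (cong (w₁ +_) (trans (identityʳ _) (·-unit ws i)))

    ·-P⁺ : ∀ i → frame w₁ ws wₙ · P⁺ i ≡ w₁ + (lookup ws i + wₙ)
    ·-P⁺ i = trans (·-frame w₁ ws wₙ true (unit i) true) (cong (λ d → w₁ + (d + wₙ)) (·-unit ws i))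

    ·-Q : frame w₁ ws wₙ · Q ≡ total ws + wₙ
    ·-Q = trans (·-frame w₁ ws wₙ false (replicate m true) true)
                (trans (identityˡ _) (cong (_+ wₙ) (·-ones ws)))

    ·-R : frame w₁ ws wₙ · R ≡ w₁ + wₙ
    ·-R = trans (·-frame w₁ ws wₙ true (replicate m false) true)
                (cong (w₁ +_) (trans (cong (_+ wₙ) (·-zeros ws)) (identityˡ wₙ)))

    ·-R⁻ : frame w₁ ws wₙ · R⁻ ≡ w₁
    ·-R⁻ = trans (·-frame w₁ ws wₙ true (replicate m false) false)
                 (trans (cong (w₁ +_) (trans (identityʳ _) (·-zeros ws))) (identityʳ w₁))

    ·-T : frame w₁ ws wₙ · T ≡ total ws
    ·-T = trans (·-frame w₁ ws wₙ false (replicate m true) false)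
                (trans (identityˡ _) (trans (identityʳ _) (·-ones ws)))

    ·-U : ∀ j → (frame w₁ ws wₙ · U j) + lookup ws j ≡ total ws + wₙ
    ·-U j = begin
      (frame w₁ ws wₙ · U j) + l ≡⟨ cong (_+ l) (trans (·-frame w₁ ws wₙ false (unitᶜ j) true) (identityˡ _)) ⟩
      (d + wₙ) + l               ≡⟨ assoc d wₙ l ⟩
      d + (wₙ + l)               ≡⟨ cong (d +_) (comm wₙ l) ⟩
      d + (l + wₙ)               ≡⟨ assoc d l wₙ ⟨
      (d + l) + wₙ               ≡⟨ cong (_+ wₙ) (·-unitᶜ ws j) ⟩
      total ws + wₙ              ∎
      where
      open ≡-Reasoning
      d = ws · unitᶜ j
      l = lookup ws j

open WeightedSum +-0-isCommutativeMonoid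
module ℚΣ = WeightedSum ℚₚ.+-0-isCommutativeMonoid

total-replicate : ∀ m c → total (replicate m c) ≡ m * c
total-replicate zero    c = refl
total-replicate (suc m) c = cong (c +_) (total-replicate m c)

total-[]≔ : ∀ {m} (ws : Vec ℕ m) i y → total (ws [ i ]≔ y) + lookup ws i ≡ total ws + y
total-[]≔ (w ∷ ws) zero    y = xy∙z≈zy∙x y (total ws) w
total-[]≔ (w ∷ ws) (suc i) y =
  trans (+-assoc w _ _) (trans (cong (w +_) (total-[]≔ ws i y)) (sym (+-assoc w _ y)))

≤-offset : ∀ {a b} d → a + d ≡ b → a ≤ b
≤-offset {a} d refl = m≤m+n a d

Represents : ∀ {n} → Vec ℚ n → ℚ → BoolFn n → Set
Represents {n} w t f = ∀ (x : Point n) → (f x ≡ false) ⇔ (dot w x ℚ.≤ t)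

represents-cong : ∀ {n} {w : Vec ℚ n} {t} {f g : BoolFn n} →
                  (∀ x → g x ≡ f x) → Represents w t g → Represents w t f
represents-cong g≗f rep x = mk⇔ (λ fx → Equivalence.to (rep x) (trans (g≗f x) fx))
                                (λ w·x≤t → trans (sym (g≗f x)) (Equivalence.from (rep x) w·x≤t))

dot≗ℚΣ : ∀ {n} (w : Vec ℚ n) x → dot w x ≡ w ℚΣ.· x
dot≗ℚΣ []      []      = refl
dot≗ℚΣ (v ∷ w) (b ∷ x) = cong (ℚΣ.select b v ℚ.+_) (dot≗ℚΣ w x)

NonNegative : ∀ {n} → Vec ℚ n → Set
NonNegative = All (0ℚ ℚ.≤_)

All-∷ʳ⁺ : ∀ {A : Set} {P : A → Set} {m} {xs : Vec A m} {x} → All P xs → P x → All P (xs ∷ʳ x)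
All-∷ʳ⁺ []         px = px ∷ []
All-∷ʳ⁺ (py ∷ pys) px = py ∷ All-∷ʳ⁺ pys px

·-mono : ∀ {n} {w : Vec ℚ n} {x y} → NonNegative w → x ⊑ y → w ℚΣ.· x ℚ.≤ w ℚΣ.· y
·-mono []            []          = ℚₚ.≤-refl
·-mono (0≤w ∷ 0≤ws) (b≤c ∷ x⊑y) = ℚₚ.+-mono-≤ (select-mono b≤c) (·-mono 0≤ws x⊑y)
  where
  select-mono : ∀ {b c} → b Bool.≤ c → ℚΣ.select b _ ℚ.≤ ℚΣ.select c _
  select-mono Bool.f≤t = 0≤w
  select-mono Bool.b≤b = ℚₚ.≤-refl

·-nonneg : ∀ {n} {w : Vec ℚ n} → NonNegative w → ∀ x → 0ℚ ℚ.≤ w ℚΣ.· x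
·-nonneg {w = w} 0≤w x = subst (ℚ._≤ w ℚΣ.· x) (ℚΣ.·-zeros w) (·-mono 0≤w (zeros-⊑ x))

represented-positive : ∀ {n} {w : Vec ℚ n} {t} {f : BoolFn n} → NonNegative w → Represents w t f → Positive f
represented-positive {w = w} 0≤w rep x y fx x⪯y =
  ¬-not λ fy →
    contradiction (trans (sym fx) (Equivalence.from (rep x) (ℚₚ.≤-trans w·x≤w·y (Equivalence.to (rep y) fy)))) λ ()
  where
  w·x≤w·y : dot w x ℚ.≤ dot w y
  w·x≤w·y = subst₂ ℚ._≤_ (sym (dot≗ℚΣ w x)) (sym (dot≗ℚΣ w y)) (·-mono 0≤w (⪯⇒⊑ x y x⪯y))

ι : ℕ → ℚ
ι n = fromℤ (ℤ.+ n)

ι-+ : ∀ a b → ι (a + b) ≡ ι a ℚ.+ ι b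
ι-+ a b = ℚₚ.toℚᵘ-injective (ℚᵘₚ.≃-trans (ℚᵘ.*≡* eq) (ℚᵘₚ.≃-sym (ℚₚ.toℚᵘ-homo-+ (ι a) (ι b))))
  where
  eq : ℤ.+ (a + b) ℤ.* ℤ.+ 1 ≡ (ℤ.+ a ℤ.* ℤ.+ 1 ℤ.+ ℤ.+ b ℤ.* ℤ.+ 1) ℤ.* ℤ.+ 1
  eq = trans (ℤₚ.*-identityʳ _)
             (sym (trans (ℤₚ.*-identityʳ _) (cong₂ ℤ._+_ (ℤₚ.*-identityʳ (ℤ.+ a)) (ℤₚ.*-identityʳ (ℤ.+ b)))))

ι-mono-≤ : ∀ {a b} → a ≤ b → ι a ℚ.≤ ι b
ι-mono-≤ {a} {b} a≤b =
  ℚ.*≤* (subst₂ ℤ._≤_ (sym (ℤₚ.*-identityʳ (ℤ.+ a))) (sym (ℤₚ.*-identityʳ (ℤ.+ b))) (ℤ.+≤+ a≤b))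

ι-cancel-≤ : ∀ {a b} → ι a ℚ.≤ ι b → a ≤ b
ι-cancel-≤ {a} {b} (ℚ.*≤* le) =
  ℤₚ.drop‿+≤+ (subst₂ ℤ._≤_ (ℤₚ.*-identityʳ (ℤ.+ a)) (ℤₚ.*-identityʳ (ℤ.+ b)) le)

ι-nonneg : ∀ {n} (w : Vec ℕ n) → NonNegative (Vec.map ι w)
ι-nonneg []      = []
ι-nonneg (k ∷ w) = ι-mono-≤ z≤n ∷ ι-nonneg w

ι-dot : ∀ {n} (w : Vec ℕ n) x → dot (Vec.map ι w) x ≡ ι (w · x)
ι-dot []      []      = refl
ι-dot (k ∷ w) (b ∷ x) = trans (cong₂ ℚ._+_ (ι-select b) (ι-dot w x)) (sym (ι-+ (select b k) (w · x)))
  where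
  ι-select : ∀ b → (if b then ι k else 0ℚ) ≡ ι (select b k)
  ι-select true  = refl
  ι-select false = refl

threshold : ∀ {n} → Vec ℕ n → ℕ → BoolFn n
threshold w t x = does (t <? w · x)

threshold-true : ∀ {n} (w : Vec ℕ n) t x {d} → w · x ≡ d → t < d → threshold w t x ≡ true
threshold-true w t x refl = dec-true (t <? w · x)

threshold-false : ∀ {n} (w : Vec ℕ n) t x {d} → w · x ≡ d → d ≤ t → threshold w t x ≡ false
threshold-false w t x refl d≤t = dec-false (t <? w · x) (≤⇒≯ d≤t)

threshold-represented : ∀ {n} (w : Vec ℕ n) t → Represents (Vec.map ι w) (ι t) (threshold w t)
threshold-represented w t x = mk⇔ to from
  where
  to : threshold w t x ≡ false → dot (Vec.map ι w) x ℚ.≤ ι t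
  to gx = subst (ℚ._≤ ι t) (sym (ι-dot w x))
    (ι-mono-≤ (≮⇒≥ λ t<w·x → contradiction (trans (sym gx) (threshold-true w t x refl t<w·x)) λ ()))
  from : dot (Vec.map ι w) x ℚ.≤ ι t → threshold w t x ≡ false
  from le = threshold-false w t x refl (ι-cancel-≤ (subst (ℚ._≤ ι t) (ι-dot w x) le))

threshold-isThreshold : ∀ {n} (w : Vec ℕ n) t → IsThreshold (threshold w t)
threshold-isThreshold w t = Vec.map ι w , ι t , threshold-represented w t

threshold-positive : ∀ {n} (w : Vec ℕ n) t → Positive (threshold w t)
threshold-positive w t = represented-positive (ι-nonneg w) (threshold-represented w t)

module UniformThreshold {p : ℕ} (w₁ c wₙ t : ℕ) where

  cs : Vec ℕ (suc p)
  cs = replicate (suc p) c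

  weights : Vec ℕ (3 + p)
  weights = frame w₁ cs wₙ

  g : BoolFn (3 + p)
  g = threshold weights t

  total-cs : total cs ≡ suc p * c
  total-cs = total-replicate (suc p) c

  true-at-P : t < w₁ + c → ∀ i → g (P i) ≡ true
  true-at-P t< i =
    threshold-true weights t (P i) (trans (·-P w₁ cs wₙ i) (cong (w₁ +_) (lookup-replicate i c))) t<

  true-at-Q : t < suc p * c + wₙ → g Q ≡ true
  true-at-Q = threshold-true weights t Q (trans (·-Q w₁ cs wₙ) (cong (_+ wₙ) total-cs))

  false-at-Q : suc p * c + wₙ ≤ t → g Q ≡ false
  false-at-Q = threshold-false weights t Q (trans (·-Q w₁ cs wₙ) (cong (_+ wₙ) total-cs))

  true-at-R : t < w₁ + wₙ → g R ≡ true
  true-at-R = threshold-true weights t R (·-R w₁ cs wₙ)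

  false-at-R : w₁ + wₙ ≤ t → g R ≡ false
  false-at-R = threshold-false weights t R (·-R w₁ cs wₙ)

  false-at-R⁻ : w₁ ≤ t → g R⁻ ≡ false
  false-at-R⁻ = threshold-false weights t R⁻ (·-R⁻ w₁ cs wₙ)

  true-at-T : t < suc p * c → g T ≡ true
  true-at-T = threshold-true weights t T (trans (·-T w₁ cs wₙ) total-cs)

  false-at-T : suc p * c ≤ t → g T ≡ false
  false-at-T = threshold-false weights t T (trans (·-T w₁ cs wₙ) total-cs)

  false-at-U : p * c + wₙ ≤ t → ∀ j → g (U j) ≡ false
  false-at-U le j = threshold-false weights t (U j) w·Uⱼ le
    where
    open ≡-Reasoning
    w·Uⱼ : weights · U j ≡ p * c + wₙ
    w·Uⱼ = +-cancelʳ-≡ c _ _ (begin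
      weights · U j + c            ≡⟨ cong (weights · U j +_) (lookup-replicate j c) ⟨
      weights · U j + lookup cs j  ≡⟨ ·-U w₁ cs wₙ j ⟩
      total cs + wₙ                ≡⟨ cong (_+ wₙ) total-cs ⟩
      (c + p * c) + wₙ             ≡⟨ xy∙z≈yz∙x c (p * c) wₙ ⟩
      (p * c + wₙ) + c             ∎)

module FnThreshold (p : ℕ) = UniformThreshold {p} (1 + 2 * p) 2 1 (2 + 2 * p)

fn-as-threshold : ∀ p x → FnThreshold.g p x ≡ fn x
fn-as-threshold p = fn-determined
  (true-at-P (≤-offset 0 (solve [ p ])))
  (true-at-Q (≤-offset 0 (solve [ p ])))
  (false-at-R (≤-offset 0 (solve [ p ])))
  (false-at-T (≤-offset 0 (solve [ p ])))
  (false-at-U (≤-offset 1 (solve [ p ])))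
  where
  open FnThreshold p
  open Agreement (threshold-positive weights (2 + 2 * p))

fn-represented : ∀ p → Represents (Vec.map ι (FnThreshold.weights p)) (ι (2 + 2 * p)) fn
fn-represented p = represents-cong {w = Vec.map ι (FnThreshold.weights p)} (fn-as-threshold p)
                                   (threshold-represented (FnThreshold.weights p) (2 + 2 * p))

fn-isThreshold : ∀ p → IsThreshold (fn {3 + p})
fn-isThreshold p = Vec.map ι (FnThreshold.weights p) , ι (2 + 2 * p) , fn-represented p

fn-positive : ∀ p → Positive (fn {3 + p})
fn-positive p = represented-positive (ι-nonneg (FnThreshold.weights p)) (fn-represented p)

-- The specification number

+-cancelˡ-< : ∀ a {b c} → a ℚ.+ b ℚ.< a ℚ.+ c → b ℚ.< c
+-cancelˡ-< a a+b<a+c = ℚₚ.≰⇒> λ c≤b → ℚₚ.<-irrefl refl (ℚₚ.<-≤-trans a+b<a+c (ℚₚ.+-monoʳ-≤ a c≤b))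

+-cancelʳ-< : ∀ a {b c} → b ℚ.+ a ℚ.< c ℚ.+ a → b ℚ.< c
+-cancelʳ-< a b+a<c+a = ℚₚ.≰⇒> λ c≤b → ℚₚ.<-irrefl refl (ℚₚ.<-≤-trans b+a<c+a (ℚₚ.+-monoˡ-≤ a c≤b))

threshold-determined : ∀ {p} {g : BoolFn (3 + p)} → IsThreshold g →
                       (∀ j → g (P j) ≡ true) → g Q ≡ true → g R ≡ false → g T ≡ false → ∀ x → g x ≡ fn x
threshold-determined {g = g} (w , s , rep) gP gQ gR gT with frameView w
... | framed w₁ ws wₙ = Agreement.fn-determined g-positive gP gQ gR gT gU
  where
  V = ℚΣ.total ws

  false-iff : ∀ x → (g x ≡ false) ⇔ (frame w₁ ws wₙ ℚΣ.· x ℚ.≤ s)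
  false-iff x = subst (λ d → (g x ≡ false) ⇔ (d ℚ.≤ s)) (dot≗ℚΣ (frame w₁ ws wₙ) x) (rep x)

  above-if-true : ∀ {x} → g x ≡ true → s ℚ.< frame w₁ ws wₙ ℚΣ.· x
  above-if-true {x} gx = ℚₚ.≰⇒> λ le → contradiction (trans (sym gx) (Equivalence.from (false-iff x) le)) λ ()

  P-above-s : ∀ j → s ℚ.< w₁ ℚ.+ lookup ws j
  P-above-s j = subst (s ℚ.<_) (ℚΣ.·-P w₁ ws wₙ j) (above-if-true (gP j))

  Q-above-s : s ℚ.< V ℚ.+ wₙ
  Q-above-s = subst (s ℚ.<_) (ℚΣ.·-Q w₁ ws wₙ) (above-if-true gQ)

  R-below-s : w₁ ℚ.+ wₙ ℚ.≤ s
  R-below-s = subst (ℚ._≤ s) (ℚΣ.·-R w₁ ws wₙ) (Equivalence.to (false-iff R) gR)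

  T-below-s : V ℚ.≤ s
  T-below-s = subst (ℚ._≤ s) (ℚΣ.·-T w₁ ws wₙ) (Equivalence.to (false-iff T) gT)

  wₙ>0 : 0ℚ ℚ.< wₙ
  wₙ>0 = +-cancelˡ-< V (ℚₚ.≤-<-trans (subst (ℚ._≤ s) (sym (ℚₚ.+-identityʳ V)) T-below-s) Q-above-s)

  wsⱼ>wₙ : ∀ j → wₙ ℚ.< lookup ws j
  wsⱼ>wₙ j = +-cancelˡ-< w₁ (ℚₚ.≤-<-trans R-below-s (P-above-s j))

  ws-nonneg : NonNegative ws
  ws-nonneg = Allₚ.lookup⁻ λ j → ℚₚ.<⇒≤ (ℚₚ.<-trans wₙ>0 (wsⱼ>wₙ j))

  w₁-nonneg : 0ℚ ℚ.≤ w₁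
  w₁-nonneg = ℚₚ.<⇒≤ (ℚₚ.≤-<-trans (·-nonneg ws-nonneg (unitᶜ zero)) (+-cancelʳ-< (lookup ws zero)
    (ℚₚ.≤-<-trans (subst (ℚ._≤ s) (sym (ℚΣ.·-unitᶜ ws zero)) T-below-s) (P-above-s zero))))

  g-positive : Positive g
  g-positive = represented-positive (w₁-nonneg ∷ All-∷ʳ⁺ ws-nonneg (ℚₚ.<⇒≤ wₙ>0)) rep

  gU : ∀ j → g (U j) ≡ false
  gU j = Equivalence.from (false-iff (U j)) (ℚₚ.<⇒≤ (ℚₚ.<-≤-trans (+-cancelʳ-< (lookup ws j)
    (subst (ℚ._< V ℚ.+ lookup ws j) (sym (ℚΣ.·-U w₁ ws wₙ j)) (ℚₚ.+-monoʳ-< V (wsⱼ>wₙ j)))) T-below-s))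

S₀ : ∀ {m} → List (Point (2 + m))
S₀ {m} = Q ∷ R ∷ T ∷ List.map P (allFin m)

S₀-length : ∀ m → length (S₀ {m}) ≡ 3 + m
S₀-length m = cong (3 +_) (trans (length-map P (allFin m)) (length-tabulate id))

All-map-P : ∀ {m} {Pr : Point (2 + m) → Set} → (∀ j → Pr (P j)) → ListAll.All Pr (List.map P (allFin m))
All-map-P {m} Pr-P = ListAllₚ.map⁺ (ListAll.universal Pr-P (allFin m))

last-differs : ∀ {m} {a a′ b b′} {mid mid′ : Point m} → b ≢ b′ → frame a mid b ≢ frame a′ mid′ b′
last-differs {mid = mid} {mid′} b≢b′ eq = b≢b′ (∷ʳ-injectiveʳ mid mid′ (∷-injectiveʳ eq))

P-injective : ∀ {m} {i j : Fin m} → P i ≡ P j → i ≡ j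
P-injective {i = i} {j} eq = unit-injective (∷ʳ-injectiveˡ (unit i) (unit j) (∷-injectiveʳ eq))

S₀-unique : ∀ {m} → Unique (S₀ {m})
S₀-unique {m} =
    ((λ ()) ∷ last-differs (λ ()) ∷ All-map-P (λ _ ()))
  ∷ ((λ ()) ∷ All-map-P (λ _ → last-differs λ ()))
  ∷ All-map-P (λ _ ())
  ∷ Uniqueₚ.map⁺ P-injective (Uniqueₚ.allFin⁺ m)

S₀-specifies : ∀ p → Specifies S₀ (fn {3 + p})
S₀-specifies p = fn-isThreshold p , agrees
  where
  agrees : ∀ g → IsThreshold g → ListAll.All (λ x → g x ≡ fn x) S₀ → ∀ x → g x ≡ fn x
  agrees g g-threshold (gQ ∷ gR ∷ gT ∷ gPs) = threshold-determined g-threshold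
    (λ j → trans (ListAll.lookup (ListAllₚ.map⁻ gPs) (∈-allFin j)) (fn-above-P (unit j) false (lookup-unit j)))
    (trans gQ (fn-Q (suc p))) (trans gR (fn-below-R p true)) (trans gT (fn-T (suc p)))

essential : ∀ {n} {S : List (Point n)} {f g : BoolFn n} {x₀} → Specifies S f → IsThreshold g →
            (∀ x → x ≢ x₀ → g x ≡ f x) → g x₀ ≢ f x₀ → x₀ ∈ S
essential {S = S} {x₀ = x₀} (_ , only-f) g-threshold g≗f g≢f with Any.any? (≡-dec Bool._≟_ x₀) S
... | yes x₀∈S = x₀∈S
... | no  x₀∉S =
  contradiction (only-f _ g-threshold (ListAll.tabulate λ {x} x∈S → g≗f x λ { refl → x₀∉S x∈S }) x₀) g≢f

≢-by-values : ∀ {a b c : Bool} → a ≡ c → b ≡ not c → a ≢ b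
≢-by-values {c = true}  refl refl ()
≢-by-values {c = false} refl refl ()

module LoweredAtP {p} (i : Fin (suc p)) where

  cs : Vec ℕ (suc p)
  cs = replicate (suc p) 2 [ i ]≔ 1

  weights : Vec ℕ (3 + p)
  weights = frame (2 * p) cs 1

  g : BoolFn (3 + p)
  g = threshold weights (1 + 2 * p)

  cs-at-i : lookup cs i ≡ 1
  cs-at-i = lookup∘updateAt i (replicate (suc p) 2)

  cs-off-i : ∀ {j} → j ≢ i → lookup cs j ≡ 2
  cs-off-i {j} j≢i = trans (lookup∘updateAt′ j i j≢i (replicate (suc p) 2)) (lookup-replicate j 2)

  cs-positive : ∀ j → 1 ≤ lookup cs j
  cs-positive j with j ≟ i
  ... | yes refl = ≤-reflexive (sym cs-at-i)
  ... | no  j≢i  = subst (1 ≤_) (sym (cs-off-i j≢i)) (s≤s z≤n)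

  total-cs : total cs ≡ 1 + 2 * p
  total-cs = +-cancelʳ-≡ 2 (total cs) (1 + 2 * p) (begin
    total cs + 2                               ≡⟨ cong (total cs +_) (lookup-replicate i 2) ⟨
    total cs + lookup (replicate (suc p) 2) i  ≡⟨ total-[]≔ (replicate (suc p) 2) i 1 ⟩
    total (replicate (suc p) 2) + 1            ≡⟨ cong (_+ 1) (total-replicate (suc p) 2) ⟩
    suc p * 2 + 1                              ≡⟨ solve [ p ] ⟩
    (1 + 2 * p) + 2                            ∎)
    where open ≡-Reasoning

  true-at-P : ∀ j → j ≢ i → g (P j) ≡ true
  true-at-P j j≢i = threshold-true weights (1 + 2 * p) (P j)
    (trans (·-P (2 * p) cs 1 j) (cong (2 * p +_) (cs-off-i j≢i))) (≤-offset 0 (solve [ p ]))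

  false-at-Pᵢ : g (P i) ≡ false
  false-at-Pᵢ = threshold-false weights (1 + 2 * p) (P i)
    (trans (·-P (2 * p) cs 1 i) (cong (2 * p +_) cs-at-i)) (≤-offset 0 (solve [ p ]))

  true-at-P⁺ : g (P⁺ i) ≡ true
  true-at-P⁺ = threshold-true weights (1 + 2 * p) (P⁺ i)
    (trans (·-P⁺ (2 * p) cs 1 i) (cong (λ c → 2 * p + (c + 1)) cs-at-i)) (≤-offset 0 (solve [ p ]))

  true-at-Q : g Q ≡ true
  true-at-Q = threshold-true weights (1 + 2 * p) Q
    (trans (·-Q (2 * p) cs 1) (cong (_+ 1) total-cs)) (≤-offset 0 (solve [ p ]))

  false-at-R : g R ≡ false
  false-at-R = threshold-false weights (1 + 2 * p) R (·-R (2 * p) cs 1) (≤-offset 0 (solve [ p ]))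

  false-at-T : g T ≡ false
  false-at-T = threshold-false weights (1 + 2 * p) T
    (trans (·-T (2 * p) cs 1) total-cs) (≤-offset 0 (solve [ p ]))

  false-at-U : ∀ j → g (U j) ≡ false
  false-at-U j = threshold-false weights (1 + 2 * p) (U j) refl (+-cancelʳ-≤ 1 _ _ (begin
    weights · U j + 1            ≤⟨ +-monoʳ-≤ (weights · U j) (cs-positive j) ⟩
    weights · U j + lookup cs j  ≡⟨ ·-U (2 * p) cs 1 j ⟩
    total cs + 1                 ≡⟨ cong (_+ 1) total-cs ⟩
    (1 + 2 * p) + 1              ∎))
    where open ≤-Reasoning

module _ {p} {S : List (Point (3 + p))} (S-specifies : Specifies S fn) where

  R∈S : R ∈ S
  R∈S = essential S-specifies (threshold-isThreshold weights (3 + 2 * p))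
    (fn↑R-determined (true-at-P (≤-offset 1 (solve [ p ]))) (true-at-Q (≤-offset 0 (solve [ p ])))
                     (false-at-R⁻ (≤-offset 0 (solve [ p ]))) (false-at-T (≤-offset 1 (solve [ p ])))
                     (false-at-U (≤-offset 1 (solve [ p ]))))
    (≢-by-values (true-at-R (≤-offset 1 (solve [ p ]))) (fn-below-R p true))
    where
    open UniformThreshold {p} (3 + 2 * p) 2 2 (3 + 2 * p)
    open Agreement (threshold-positive weights (3 + 2 * p))

  T∈S : T ∈ S
  T∈S = essential S-specifies (threshold-isThreshold weights (1 + 2 * p))
    (fn↑T-determined (true-at-P (≤-offset 1 (solve [ p ]))) (true-at-Q (≤-offset 0 (solve [ p ])))
                     (false-at-R (≤-offset 0 (solve [ p ]))) (false-at-U (≤-offset 1 (solve [ p ]))))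
    (≢-by-values (true-at-T (≤-offset 0 (solve [ p ]))) (fn-T (suc p)))
    where
    open UniformThreshold {p} (1 + 2 * p) 2 0 (1 + 2 * p)
    open Agreement (threshold-positive weights (1 + 2 * p))

  Q∈S : Q ∈ S
  Q∈S = essential S-specifies (threshold-isThreshold weights (1 + p))
    (fn↓Q-determined (true-at-P (≤-offset 0 (solve [ p ]))) (false-at-R (≤-offset 0 (solve [ p ])))
                     (false-at-T (≤-offset 0 (solve [ p ]))) (false-at-U (≤-offset 1 (solve [ p ]))))
    (≢-by-values (false-at-Q (≤-offset 0 (solve [ p ]))) (fn-Q (suc p)))
    where
    open UniformThreshold {p} (1 + p) 1 0 (1 + p)
    open Agreement (threshold-positive weights (1 + p))

  P∈S : ∀ i → P i ∈ S
  P∈S i = essential S-specifies (threshold-isThreshold weights (1 + 2 * p))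
    (Agreement.fn↓P-determined (threshold-positive weights (1 + 2 * p)) i
      true-at-P true-at-P⁺ true-at-Q false-at-R false-at-T false-at-U)
    (≢-by-values false-at-Pᵢ (fn-above-P (unit i) false (lookup-unit i)))
    where open LoweredAtP i

∈-remove : ∀ {A : Set} (ys₁ : List A) {x y ys₂} → x ≢ y → y ∈ ys₁ ++ x ∷ ys₂ → y ∈ ys₁ ++ ys₂
∈-remove ys₁ x≢y y∈ with ∈-++⁻ ys₁ y∈
... | inj₁ y∈ys₁         = ∈-++⁺ˡ y∈ys₁
... | inj₂ (here y≡x)    = contradiction (sym y≡x) x≢y
... | inj₂ (there y∈ys₂) = ∈-++⁺ʳ ys₁ y∈ys₂

unique-length-≤ : ∀ {A : Set} {xs ys : List A} → Unique xs → ListAll.All (_∈ ys) xs → length xs ≤ length ys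
unique-length-≤ []                 []             = z≤n
unique-length-≤ (x∉xs ∷ xs-unique) (x∈ys ∷ xs⊆ys) with ∈-∃++ x∈ys
... | ys₁ , ys₂ , refl = subst (suc _ ≤_) (sym (length-++-sucʳ ys₁ _ ys₂))
  (s≤s (unique-length-≤ xs-unique (ListAll.zipWith (λ (x≢y , y∈) → ∈-remove ys₁ x≢y y∈) (x∉xs , xs⊆ys))))

fn-specNumber : ∀ p → SpecNumber (fn {3 + p}) (4 + p)
fn-specNumber p =
    (S₀ , S₀-unique , S₀-length (suc p) , S₀-specifies p)
  , λ S S-specifies → subst (_≤ length S) (S₀-length (suc p)) (unique-length-≤ S₀-unique
      (Q∈S S-specifies ∷ R∈S S-specifies ∷ T∈S S-specifies ∷ All-map-P {Pr = _∈ S} (P∈S S-specifies)))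

-- Relevant variables and nested formulas

fn-dependsOnAll : ∀ p → DependsOnAll (fn {3 + p})
fn-dependsOnAll p i = switch (coordView i)
  where
  switches : ∀ x → fn x ≡ false → fn (flip x i) ≡ true → ∃ λ x → fn x ≢ fn (flip x i)
  switches x fx fx′ = x , ≢-by-values fx fx′

  switch : CoordView i → ∃ λ x → fn x ≢ fn (flip x i)
  switch first      = switches T (fn-T (suc p)) (fn-above-P (replicate (suc p) true) {zero} false refl)
  switch (middle j) = switches R⁻ (fn-below-R p false)
    (trans (cong fn (flip-middle true (replicate (suc p) false) false j))
           (fn-above-P (unit j) false (lookup-unit j)))
  switch final      = switches T (fn-T (suc p))
    (trans (cong fn (flip-final false (replicate (suc p) true) false)) (fn-Q (suc p)))

module _ {n} {f : BoolFn n}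
         (f₀ : f (replicate n false) ≡ false) (f₀ᵢ : ∀ i → f (flip (replicate n false) i) ≡ false)
         (f₁ : f (replicate n true) ≡ true) (f₁ᵢ : ∀ i → f (flip (replicate n true) i) ≡ true) where

  private
    satisfying : ∀ i s → ∃ λ x → litVal i s x ≡ true × f x ≡ false
    satisfying i true  = unit i , lookup-unit i , f₀ᵢ i
    satisfying i false = replicate n false , cong not (lookup-replicate i false) , f₀

    falsifying : ∀ i s → ∃ λ x → litVal i s x ≡ false × f x ≡ true
    falsifying i true  =
      unitᶜ i , trans (lookup∘flip (replicate n true) i) (cong not (lookup-replicate i true)) , f₁ᵢ i
    falsifying i false = replicate n true , cong not (lookup-replicate i true) , f₁

    no-outer-literal : ∀ φ → (∀ x → f x ≡ eval φ x) → ⊥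
    no-outer-literal (lit i s) f≗φ with satisfying i s
    ... | x , lit-x , fx = contradiction (trans (sym fx) (trans (f≗φ x) lit-x)) λ ()
    no-outer-literal (ext OR i s ψ) f≗φ with satisfying i s
    ... | x , lit-x , fx = contradiction (trans (sym fx) (trans (f≗φ x) (cong (_∨ eval ψ x) lit-x))) λ ()
    no-outer-literal (ext AND i s ψ) f≗φ with falsifying i s
    ... | x , lit-x , fx = contradiction (trans (sym (trans (f≗φ x) (cong (_∧ eval ψ x) lit-x))) fx) λ ()

  ¬LRO-if-false-low-true-high : ¬ LRO f
  ¬LRO-if-false-low-true-high (inj₁ (inj₁ always-true))  = contradiction (trans (sym f₀) (always-true _)) λ ()
  ¬LRO-if-false-low-true-high (inj₁ (inj₂ always-false)) = contradiction (trans (sym (always-false _)) f₁) λ ()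
  ¬LRO-if-false-low-true-high (inj₂ (φ , _ , f≗φ))       = no-outer-literal φ f≗φ

fn-¬LRO : ∀ k → ¬ LRO (fn {4 + k})
fn-¬LRO k = ¬LRO-if-false-low-true-high
  (subst (λ z → fn z ≡ false) (sym (replicate-frame (2 + k) false)) (fn-below-U Z {zero} false refl))
  (λ i → subst (λ z → fn (flip z i) ≡ false) (sym (replicate-frame (2 + k) false)) (near-zeros i (coordView i)))
  (subst (λ z → fn z ≡ true) (sym (replicate-frame (2 + k) true)) (fn-above-P O {zero} true refl))
  (λ i → subst (λ z → fn (flip z i) ≡ true) (sym (replicate-frame (2 + k) true)) (near-ones i (coordView i)))
  where
  Z O : Point (2 + k)
  Z = replicate (2 + k) false
  O = replicate (2 + k) true

  near-zeros : ∀ i → CoordView i → fn (flip (frame false Z false) i) ≡ false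
  near-zeros _ first      = fn-below-R (suc k) false
  near-zeros _ (middle j) = trans (cong fn (flip-middle false Z false j))
                                  (fn-below-U (unit j) false (lookup-unit′ (proj₂ (another j))))
  near-zeros _ final      = trans (cong fn (flip-final false Z false)) (fn-below-U Z {zero} true refl)

  near-ones : ∀ i → CoordView i → fn (flip (frame true O true) i) ≡ true
  near-ones _ first      = fn-Q (2 + k)
  near-ones _ (middle j) = trans (cong fn (flip-middle true O true j))
                                 (fn-above-P (unitᶜ j) true (lookup-unitᶜ′ (proj₂ (another j))))
  near-ones _ final      = trans (cong fn (flip-final true O true)) (fn-above-P O {zero} false refl)

theorem9 : (n : ℕ) → 4 ≤ n →
    Positive (fn {n}) × IsThreshold (fn {n}) × DependsOnAll (fn {n})
    × ¬ LRO (fn {n}) × SpecNumber (fn {n}) (suc n)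
theorem9 (suc (suc (suc (suc k)))) (s≤s (s≤s (s≤s (s≤s _)))) =
  fn-positive (suc k) , fn-isThreshold (suc k) , fn-dependsOnAll (suc k) , fn-¬LRO k , fn-specNumber (suc k)
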